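{- (1) Let $n,r$ be positive integers. Then there exists $N$ such that for all integers $s,t$ with $s>t\ge N$ (so in particular $s>t\ge1$ and $(s,-t)\ne(2,-1)$), $$\left\lfloor \left(\sum_{k=n}^\infty \frac{1}{f_{rk}(s,-t)}\right)^{ -1}\right\rfloor = f_{rn}(s,-t)-f_{r(n-1)}(s,-t)-1.$$ (2) Let $n,r$ be positive integers. Then there exists $S$ such that for all integers $s\ge S$, $$\left\lfloor \left(\sum_{k=n}^\infty \frac{1}{f_{rk}(s,-1)^2}\right)^{ -1}\right\rfloor = f_{rn}(s,-1)^2-f_{r(n-1)}(s,-1)^2-1.$$
   Context: For integers $s,t$, the generalized Fibonacci sequence is $f_0(s,t)=0$, $f_1(s,t)=1$, $f_n(s,t)=s f_{n-1}(s,t)+t f_{n-2}(s,t)$ for $n\ge2$. $\lfloor x\rfloor$ denotes the floor of a real number $x$. (The paper phrases the hypotheses as "if $s,t$ are sufficiently large" and "if $s$ is sufficiently large", for fixed $n,r$.) -}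

module Defs where

open import Data.Nat as ℕ using (ℕ; zero; suc)
open import Data.Integer as ℤ using (ℤ; +_; -[1+_])
open import Data.Rational as ℚ using (ℚ)
open import Data.Product using (_×_; ∃-syntax)

fib : ℤ → ℤ → ℕ → ℤ
fib s t zero = + 0
fib s t (suc zero) = + 1
fib s t (suc (suc k)) = s ℤ.* fib s t (suc k) ℤ.+ t ℤ.* fib s t k

-- reciprocal of an integer as a rational (convention 1/0 := 0; never used
-- under the theorem's hypotheses, where all denominators are positive)
recip : ℤ → ℚ
recip (+ zero) = ℚ.0ℚ
recip (+ suc k) = (+ 1) ℚ./ suc k
recip -[1+ k ] = ℤ.-[1+ 0 ] ℚ./ suc k

partial : (ℕ → ℚ) → ℕ → ℚ
partial a zero = a 0
partial a (suc j) = partial a j ℚ.+ a (suc j)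

-- "the series Σ_{i≥0} a i (of positive rationals) converges to a real S > 0
--  with ⌊ S⁻¹ ⌋ = m", stated without reals:
--  all terms positive, m·S ≤ 1 (i.e. every partial sum P satisfies m·P ≤ 1),
--  and (m+1)·S > 1 (i.e. some partial sum P satisfies (m+1)·P > 1).
FloorInvSeries : (ℕ → ℚ) → ℤ → Set
FloorInvSeries a m =
  (∀ i → ℚ.0ℚ ℚ.< a i)
  × (∀ j → (m ℚ./ 1) ℚ.* partial a j ℚ.≤ ℚ.1ℚ)
  × (∃[ j ] ℚ.1ℚ ℚ.< ((m ℤ.+ + 1) ℚ./ 1) ℚ.* partial a j)

module Submission where

-- Let a < b < c be consecutive terms of x_k = f_{rk} (resp. f_{rk}²) and Δ = b² − ac.
-- If 0 < Δ < c − b, then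
--   1/(b − a) < 1/b + 1/(c − b)   and   1/b + 1/(c − b − 1) ≤ 1/(b − a − 1),
-- and the differences b − a increase, so telescoping over the tail k ≥ n gives
--   1/d < Σ_{k≥n} 1/x_k ≤ 1/(d − 1)   for d = x_n − x_{n−1},
-- i.e. the floor of the inverse is d − 1.  Catalan's identity
-- f_{m+r}² − f_m f_{m+2r} = f_r² t^m shows Δ > 0.  For t ≥ 2 the gap f_{m+2r} − f_{m+r}
-- is at least t^m f_r² + 1, and for t = 1, s ≥ 5 one has f_{m+2r} ≥ 3 f_r f_{m+r},
-- which makes the gap of the squares exceed Δ.

open import Defs
open import Data.Nat as ℕ using (ℕ; zero; suc)
import Data.Nat.Properties as ℕP
open import Data.Integer as ℤ using (ℤ; +_; -_; 0ℤ; 1ℤ; _+_; _-_; _*_; _^_; _≤_; _<_)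
import Data.Integer.Properties as ℤP
open import Data.Integer.Tactic.RingSolver using (solve-∀)
open import Data.Rational as ℚ using (ℚ)
import Data.Rational.Properties as ℚP
open import Data.Rational.Unnormalised as ℚᵘ using (ℚᵘ; mkℚᵘ)
import Data.Rational.Unnormalised.Properties as ℚᵘP
open import Data.Product using (_×_; ∃-syntax; _,_; proj₁; proj₂)
open import Relation.Binary.PropositionalEquality

+-pres-0≤ : ∀ {i j} → 0ℤ ≤ i → 0ℤ ≤ j → 0ℤ ≤ i + j
+-pres-0≤ = ℤP.+-mono-≤

*-pres-0≤ : ∀ {i j} → 0ℤ ≤ i → 0ℤ ≤ j → 0ℤ ≤ i * j
*-pres-0≤ {j = j} 0≤i 0≤j = ℤP.*-monoʳ-≤-nonNeg j {{ℤ.nonNegative 0≤j}} 0≤i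

1≤⇒0≤ : ∀ {i} → 1ℤ ≤ i → 0ℤ ≤ i
1≤⇒0≤ = ℤP.≤-trans (ℤ.+≤+ ℕ.z≤n)

≤-by-difference : ∀ {i j} k → j - i ≡ k → 0ℤ ≤ k → i ≤ j
≤-by-difference k j-i≡k 0≤k = ℤP.0≤i-j⇒j≤i (subst (0ℤ ≤_) (sym j-i≡k) 0≤k)

private
  j-[1+i]≡j-i-1 : ∀ i j → j - (1ℤ + i) ≡ j - i - 1ℤ
  j-[1+i]≡j-i-1 = solve-∀

<-by-difference : ∀ {i j} k → j - i ≡ k → 1ℤ ≤ k → i < j
<-by-difference {i} {j} k j-i≡k 1≤k = ℤP.suc[i]≤j⇒i<j (ℤP.0≤i-j⇒j≤i
  (subst (0ℤ ≤_) (sym (j-[1+i]≡j-i-1 i j)) (ℤP.i≤j⇒0≤j-i (subst (1ℤ ≤_) (sym j-i≡k) 1≤k))))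

*-pres-1≤ : ∀ {i j} → 1ℤ ≤ i → 1ℤ ≤ j → 1ℤ ≤ i * j
*-pres-1≤ {i} {j} 1≤i 1≤j = ≤-by-difference _ (cert i j)
  (+-pres-0≤ (+-pres-0≤ (*-pres-0≤ 0≤i-1 0≤j-1) 0≤i-1) 0≤j-1)
  where
  0≤i-1 = ℤP.i≤j⇒0≤j-i 1≤i
  0≤j-1 = ℤP.i≤j⇒0≤j-i 1≤j
  cert : ∀ i j → i * j - 1ℤ ≡ (i - 1ℤ) * (j - 1ℤ) + (i - 1ℤ) + (j - 1ℤ)
  cert = solve-∀

i<j⇒1≤j-i : ∀ {i j} → i < j → 1ℤ ≤ j - i
i<j⇒1≤j-i {i} {j} i<j =
  ℤP.0≤i-j⇒j≤i (subst (0ℤ ≤_) (j-[1+i]≡j-i-1 i j) (ℤP.i≤j⇒0≤j-i (ℤP.i<j⇒suc[i]≤j i<j)))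

0≤i<j⇒1≤j : ∀ {i j} → 0ℤ ≤ i → i < j → 1ℤ ≤ j
0≤i<j⇒1≤j 0≤i i<j = ℤP.≤-trans (ℤP.+-monoʳ-≤ 1ℤ 0≤i) (ℤP.i<j⇒suc[i]≤j i<j)

mono-of-step : (a : ℕ → ℤ) → (∀ i → a i ≤ a (suc i)) → ∀ {m n} → m ℕ.≤ n → a m ≤ a n
mono-of-step a step m≤n = go (ℕP.≤⇒≤′ m≤n)
  where
  go : ∀ {m n} → m ℕ.≤′ n → a m ≤ a n
  go (ℕ.≤′-reflexive refl) = ℤP.≤-refl
  go (ℕ.≤′-step m≤′n) = ℤP.≤-trans (go m≤′n) (step _)

strictMono-of-step : (a : ℕ → ℤ) → (∀ i → a i < a (suc i)) → ∀ {m n} → m ℕ.< n → a m < a n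
strictMono-of-step a step {m} m<n =
  ℤP.<-≤-trans (step m) (mono-of-step a (λ i → ℤP.<⇒≤ (step i)) m<n)

^-pres-1≤ : ∀ {i} → 1ℤ ≤ i → ∀ n → 1ℤ ≤ i ^ n
^-pres-1≤ 1≤i zero = ℤP.≤-refl
^-pres-1≤ 1≤i (suc n) = *-pres-1≤ 1≤i (^-pres-1≤ 1≤i n)

data IsSuc : ℤ → Set where
  +suc : ∀ k → IsSuc (+ suc k)

isSuc : ∀ {i} → 1ℤ ≤ i → IsSuc i
isSuc {+ suc k} _ = +suc k
isSuc {+ zero} (ℤ.+≤+ ())

1/suc : ℕ → ℚᵘ
1/suc k = mkℚᵘ (+ 1) k

toℚᵘ-recip : ∀ k → ℚ.toℚᵘ (recip (+ suc k)) ℚᵘ.≃ 1/suc k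
toℚᵘ-recip k = ℚP.toℚᵘ-fromℚᵘ (1/suc k)

toℚᵘ-recip-+ : ∀ k l → ℚ.toℚᵘ (recip (+ suc k) ℚ.+ recip (+ suc l)) ℚᵘ.≃ 1/suc k ℚᵘ.+ 1/suc l
toℚᵘ-recip-+ k l = ℚᵘP.≃-trans (ℚP.toℚᵘ-homo-+ (recip (+ suc k)) (recip (+ suc l)))
  (ℚᵘP.+-cong (toℚᵘ-recip k) (toℚᵘ-recip l))

≤-via-toℚᵘ : ∀ {p q p′ q′} → ℚ.toℚᵘ p ℚᵘ.≃ p′ → ℚ.toℚᵘ q ℚᵘ.≃ q′ → p′ ℚᵘ.≤ q′ → p ℚ.≤ q
≤-via-toℚᵘ p≃ q≃ p′≤q′ =
  ℚP.toℚᵘ-cancel-≤ (ℚᵘP.≤-respʳ-≃ (ℚᵘP.≃-sym q≃) (ℚᵘP.≤-respˡ-≃ (ℚᵘP.≃-sym p≃) p′≤q′))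

<-via-toℚᵘ : ∀ {p q p′ q′} → ℚ.toℚᵘ p ℚᵘ.≃ p′ → ℚ.toℚᵘ q ℚᵘ.≃ q′ → p′ ℚᵘ.< q′ → p ℚ.< q
<-via-toℚᵘ p≃ q≃ p′<q′ =
  ℚP.toℚᵘ-cancel-< (ℚᵘP.<-respʳ-≃ (ℚᵘP.≃-sym q≃) (ℚᵘP.<-respˡ-≃ (ℚᵘP.≃-sym p≃) p′<q′))

recip-pos : ∀ {i} → 1ℤ ≤ i → ℚ.0ℚ ℚ.< recip i
recip-pos 1≤i with isSuc 1≤i
... | +suc k = ℚP.positive⁻¹ _ {{ℚP.normalize-pos 1 (suc k)}}

recip-≤-recip-+-recip : ∀ {y d e} → 1ℤ ≤ y → 1ℤ ≤ d → 1ℤ ≤ e →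
                        y * e ≤ d * (e + y) → recip d ℚ.≤ recip y ℚ.+ recip e
recip-≤-recip-+-recip 1≤y 1≤d 1≤e ye≤d[e+y] with isSuc 1≤y | isSuc 1≤d | isSuc 1≤e
... | +suc y | +suc d | +suc e = ≤-via-toℚᵘ (toℚᵘ-recip d) (toℚᵘ-recip-+ y e)
  (ℚᵘ.*≤* (subst₂ _≤_ (lhs (+ suc y) (+ suc e)) (rhs (+ suc y) (+ suc e) (+ suc d)) ye≤d[e+y]))
  where
  lhs : ∀ y e → y * e ≡ 1ℤ * (y * e)
  lhs = solve-∀
  rhs : ∀ y e d → d * (e + y) ≡ (1ℤ * e + 1ℤ * y) * d
  rhs = solve-∀

recip-+-recip-≤-recip : ∀ {y d e} → 1ℤ ≤ y → 1ℤ ≤ d → 1ℤ ≤ e →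
                        d * (e + y) ≤ y * e → recip y ℚ.+ recip e ℚ.≤ recip d
recip-+-recip-≤-recip 1≤y 1≤d 1≤e d[e+y]≤ye with isSuc 1≤y | isSuc 1≤d | isSuc 1≤e
... | +suc y | +suc d | +suc e = ≤-via-toℚᵘ (toℚᵘ-recip-+ y e) (toℚᵘ-recip d)
  (ℚᵘ.*≤* (subst₂ _≤_ (lhs (+ suc y) (+ suc e) (+ suc d)) (rhs (+ suc y) (+ suc e)) d[e+y]≤ye))
  where
  lhs : ∀ y e d → d * (e + y) ≡ (1ℤ * e + 1ℤ * y) * d
  lhs = solve-∀
  rhs : ∀ y e → y * e ≡ 1ℤ * (y * e)
  rhs = solve-∀

toℚᵘ-scaled : ∀ k p → ℚ.toℚᵘ ((+ suc k ℚ./ 1) ℚ.* p) ℚᵘ.≃ mkℚᵘ (+ suc k) 0 ℚᵘ.* ℚ.toℚᵘ p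
toℚᵘ-scaled k p = ℚᵘP.≃-trans (ℚP.toℚᵘ-homo-* (+ suc k ℚ./ 1) p)
  (ℚᵘP.*-cong (ℚP.toℚᵘ-fromℚᵘ (mkℚᵘ (+ suc k) 0)) ℚᵘP.≃-refl)

-- The guard 1 ≤ m avoids demanding p ≤ recip 0 = 0 in the trivial case m = 0.
≤-recip⇒*≤1 : ∀ {m} (p : ℚ) → 0ℤ ≤ m → (1ℤ ≤ m → p ℚ.≤ recip m) → (m ℚ./ 1) ℚ.* p ℚ.≤ ℚ.1ℚ
≤-recip⇒*≤1 {+ zero} p _ _ = ℚP.≤-trans (ℚP.≤-reflexive (ℚP.*-zeroˡ p)) (ℚ.*≤* (ℤ.+≤+ ℕ.z≤n))
≤-recip⇒*≤1 {+ suc k} p _ p≤recip = ≤-via-toℚᵘ (toℚᵘ-scaled k p) ℚᵘP.≃-refl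
  (ℚᵘP.≤-trans (ℚᵘP.*-monoʳ-≤-nonNeg (mkℚᵘ (+ suc k) 0) p≤1/suc)
    (ℚᵘ.*≤* (ℤP.≤-reflexive (cong (λ n → + suc n) (k*1*1≡k+0+0 k)))))
  where
  p≤1/suc : ℚ.toℚᵘ p ℚᵘ.≤ 1/suc k
  p≤1/suc = ℚᵘP.≤-respʳ-≃ (toℚᵘ-recip k) (ℚP.toℚᵘ-mono-≤ (p≤recip (ℤ.+≤+ (ℕ.s≤s ℕ.z≤n))))
  k*1*1≡k+0+0 : ∀ k → k ℕ.* 1 ℕ.* 1 ≡ k ℕ.+ 0 ℕ.+ 0
  k*1*1≡k+0+0 k = trans (ℕP.*-identityʳ (k ℕ.* 1)) (trans (ℕP.*-identityʳ k)
          (sym (trans (ℕP.+-identityʳ (k ℕ.+ 0)) (ℕP.+-identityʳ k))))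

partial-+-≤-telescope : (a E : ℕ → ℚ) → (∀ i → a i ℚ.+ E (suc i) ℚ.≤ E i) →
                        ∀ j → partial a j ℚ.+ E (suc j) ℚ.≤ E 0
partial-+-≤-telescope a E step zero = step 0
partial-+-≤-telescope a E step (suc j) = begin
  partial a j ℚ.+ a (suc j) ℚ.+ E (suc (suc j))   ≡⟨ ℚP.+-assoc (partial a j) _ _ ⟩
  partial a j ℚ.+ (a (suc j) ℚ.+ E (suc (suc j))) ≤⟨ ℚP.+-monoʳ-≤ (partial a j) (step (suc j)) ⟩
  partial a j ℚ.+ E (suc j)                       ≤⟨ partial-+-≤-telescope a E step j ⟩
  E 0                                             ∎
  where open ℚP.≤-Reasoning

partial-+-≥-telescope : (a F : ℕ → ℚ) → (∀ i → F (suc i) ℚ.≤ a (suc i) ℚ.+ F (suc (suc i))) →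
                        ∀ j → a 0 ℚ.+ F 1 ℚ.≤ partial a j ℚ.+ F (suc j)
partial-+-≥-telescope a F step zero = ℚP.≤-refl
partial-+-≥-telescope a F step (suc j) = begin
  a 0 ℚ.+ F 1                                     ≤⟨ partial-+-≥-telescope a F step j ⟩
  partial a j ℚ.+ F (suc j)                       ≤⟨ ℚP.+-monoʳ-≤ (partial a j) (step j) ⟩
  partial a j ℚ.+ (a (suc j) ℚ.+ F (suc (suc j))) ≡⟨ ℚP.+-assoc (partial a j) _ _ ⟨
  partial a j ℚ.+ a (suc j) ℚ.+ F (suc (suc j))   ∎
  where open ℚP.≤-Reasoning

cleared-margin : ∀ y d₀ d₁ e → 0ℤ ≤ e → y * d₁ < d₀ * (d₁ + y) → y * d₀ * d₁ < e →
                 y * d₁ * e < d₀ * ((d₁ + y) * e - y * d₁)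
cleared-margin y d₀ d₁ e 0≤e d₀-margin e-large = <-by-difference _ (cert y d₀ d₁ e)
  (ℤP.+-mono-≤ (i<j⇒1≤j-i e-large) (*-pres-0≤ 0≤e (ℤP.i≤j⇒0≤j-i (ℤP.i<j⇒suc[i]≤j d₀-margin))))
  where
  cert : ∀ y d₀ d₁ e → d₀ * ((d₁ + y) * e - y * d₁) - y * d₁ * e
                     ≡ (e - y * d₀ * d₁) + e * (d₀ * (d₁ + y) - (1ℤ + y * d₁))
  cert = solve-∀

1<*-1/suc-margin : ∀ d₀ y d₁ e →
  + suc y * + suc d₁ * + suc e < + suc d₀ * ((+ suc d₁ + + suc y) * + suc e - + suc y * + suc d₁) →
  ℚᵘ.1ℚᵘ ℚᵘ.< mkℚᵘ (+ suc d₀) 0 ℚᵘ.* ((1/suc y ℚᵘ.+ 1/suc d₁) ℚᵘ.- 1/suc e)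
1<*-1/suc-margin d₀ y d₁ e ineq = ℚᵘ.*<* (subst₂ _<_
  (sym (trans (ℤP.*-identityˡ _) (cong +_ (ℕP.+-identityʳ _))))
  (trans (num (+ suc d₀) (+ suc y) (+ suc d₁) (+ suc e)) (sym (ℤP.*-identityʳ _)))
  ineq)
  where
  num : ∀ a b c d → a * ((c + b) * d - b * c) ≡ a * ((1ℤ * c + 1ℤ * b) * d + (- 1ℤ) * (b * c))
  num = solve-∀

-- d₀(1/y + 1/d₁) exceeds 1 by at least 1/(y d₁), which is more than d₀/e.
1<*-by-margin : ∀ {y d₀ d₁ e} (p : ℚ) → 1ℤ ≤ y → 1ℤ ≤ d₀ → 1ℤ ≤ d₁ → 1ℤ ≤ e →
                y * d₁ < d₀ * (d₁ + y) → y * d₀ * d₁ < e →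
                recip y ℚ.+ recip d₁ ℚ.≤ p ℚ.+ recip e → ℚ.1ℚ ℚ.< (d₀ ℚ./ 1) ℚ.* p
1<*-by-margin p 1≤y 1≤d₀ 1≤d₁ 1≤e d₀-margin e-large q≤p+r
  with isSuc 1≤y | isSuc 1≤d₀ | isSuc 1≤d₁ | isSuc 1≤e
... | +suc y | +suc d₀ | +suc d₁ | +suc e = <-via-toℚᵘ ℚᵘP.≃-refl (toℚᵘ-scaled d₀ p)
  (ℚᵘP.<-≤-trans
    (1<*-1/suc-margin d₀ y d₁ e
      (cleared-margin (+ suc y) (+ suc d₀) (+ suc d₁) (+ suc e) (ℤ.+≤+ ℕ.z≤n) d₀-margin e-large))
    (ℚᵘP.*-monoʳ-≤-nonNeg (mkℚᵘ (+ suc d₀) 0) q-r≤P))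
  where
  P = ℚ.toℚᵘ p
  r = 1/suc e
  q≤P+r : 1/suc y ℚᵘ.+ 1/suc d₁ ℚᵘ.≤ P ℚᵘ.+ r
  q≤P+r = ℚᵘP.≤-respʳ-≃
    (ℚᵘP.≃-trans (ℚP.toℚᵘ-homo-+ p (recip (+ suc e))) (ℚᵘP.+-congʳ P (toℚᵘ-recip e)))
    (ℚᵘP.≤-respˡ-≃ (toℚᵘ-recip-+ y d₁) (ℚP.toℚᵘ-mono-≤ q≤p+r))
  P+r-r≃P : P ℚᵘ.+ r ℚᵘ.- r ℚᵘ.≃ P
  P+r-r≃P = ℚᵘP.≃-trans (ℚᵘP.+-assoc P r (ℚᵘ.- r))
              (ℚᵘP.≃-trans (ℚᵘP.+-congʳ P (ℚᵘP.+-inverseʳ r)) (ℚᵘP.+-identityʳ P))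
  q-r≤P : 1/suc y ℚᵘ.+ 1/suc d₁ ℚᵘ.- r ℚᵘ.≤ P
  q-r≤P = ℚᵘP.≤-respʳ-≃ P+r-r≃P (ℚᵘP.+-monoˡ-≤ (ℚᵘ.- r) q≤P+r)

cassini : ℤ → ℤ → ℤ → ℤ
cassini a b c = b * b - a * c

record CassiniBounded (a b c : ℤ) : Set where
  field
    0≤a         : 0ℤ ≤ a
    a<b         : a < b
    0<cassini   : 0ℤ < cassini a b c
    cassini<c-b : cassini a b c < c - b

module _ {a b c : ℤ} (bounded : CassiniBounded a b c) where
  open CassiniBounded bounded

  private
    1≤cassini : 1ℤ ≤ cassini a b c
    1≤cassini = ℤP.i<j⇒suc[i]≤j 0<cassini

  gap-increasing : b - a < c - b
  gap-increasing = ℤP.*-cancelˡ-<-nonNeg (1ℤ + a) {{ℤ.nonNegative (ℤP.i≤j⇒i≤k+j 1ℤ 0≤a)}}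
    (<-by-difference _ (cert a b c)
      (ℤP.+-mono-≤ (i<j⇒1≤j-i cassini<c-b) (*-pres-0≤ (1≤⇒0≤ 1≤b-a) (ℤP.i≤j⇒0≤j-i 1≤b-a))))
    where
    1≤b-a = i<j⇒1≤j-i a<b
    cert : ∀ a b c → (1ℤ + a) * (c - b) - (1ℤ + a) * (b - a)
                   ≡ (c - b - (b * b - a * c)) + (b - a) * (b - a - 1ℤ)
    cert = solve-∀

  reciprocal-lower-step : b * (c - b) < (b - a) * ((c - b) + b)
  reciprocal-lower-step = <-by-difference (cassini a b c) (cert a b c) 1≤cassini
    where
    cert : ∀ a b c → (b - a) * ((c - b) + b) - b * (c - b) ≡ b * b - a * c
    cert = solve-∀

  reciprocal-upper-step : (b - a - 1ℤ) * ((c - b - 1ℤ) + b) ≤ b * (c - b - 1ℤ)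
  reciprocal-upper-step = ≤-by-difference _ (cert a b c)
    (+-pres-0≤ (ℤP.i≤j⇒0≤j-i (i<j⇒1≤j-i cassini<c-b)) (1≤⇒0≤ (i<j⇒1≤j-i a<b)))
    where
    cert : ∀ a b c → b * (c - b - 1ℤ) - (b - a - 1ℤ) * ((c - b - 1ℤ) + b)
                   ≡ (c - b - (b * b - a * c) - 1ℤ) + (b - a)
    cert = solve-∀

module CassiniBoundedSequence (x : ℕ → ℤ)
  (bounded : ∀ k → CassiniBounded (x k) (x (suc k)) (x (suc (suc k)))) where

  Y : ℕ → ℤ
  Y i = x (suc i)

  D : ℕ → ℤ
  D i = x (suc i) - x i

  term : ℕ → ℚ
  term i = recip (Y i)

  1≤Y : ∀ i → 1ℤ ≤ Y i
  1≤Y i = 0≤i<j⇒1≤j (CassiniBounded.0≤a (bounded i)) (CassiniBounded.a<b (bounded i))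

  1≤D : ∀ i → 1ℤ ≤ D i
  1≤D i = i<j⇒1≤j-i (CassiniBounded.a<b (bounded i))

  index<D : ∀ i → + i < D i
  index<D zero = ℤP.<-≤-trans (ℤ.+<+ (ℕ.s≤s ℕ.z≤n)) (1≤D 0)
  index<D (suc i) = ℤP.≤-<-trans (ℤP.i<j⇒suc[i]≤j (index<D i)) (gap-increasing (bounded i))

  partial-lower : ∀ j → recip (Y 0) ℚ.+ recip (D 1) ℚ.≤ partial term j ℚ.+ recip (D (suc j))
  partial-lower = partial-+-≥-telescope term (λ i → recip (D i)) λ i →
    recip-≤-recip-+-recip (1≤Y (suc i)) (1≤D (suc i)) (1≤D (suc (suc i)))
      (ℤP.<⇒≤ (reciprocal-lower-step (bounded (suc i))))

  partial-upper : 1ℤ ≤ D 0 - 1ℤ → ∀ j → partial term j ℚ.≤ recip (D 0 - 1ℤ)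
  partial-upper 1≤D₀-1 j = begin
    partial term j                       ≡⟨ ℚP.+-identityʳ (partial term j) ⟨
    partial term j ℚ.+ ℚ.0ℚ              ≤⟨ ℚP.+-monoʳ-≤ (partial term j) (ℚP.<⇒≤ (recip-pos (1≤D-1 (suc j)))) ⟩
    partial term j ℚ.+ E (suc j)         ≤⟨ partial-+-≤-telescope term E step j ⟩
    E 0                                  ∎
    where
    open ℚP.≤-Reasoning
    E : ℕ → ℚ
    E i = recip (D i - 1ℤ)
    1≤D-1 : ∀ i → 1ℤ ≤ D i - 1ℤ
    1≤D-1 zero = 1≤D₀-1
    1≤D-1 (suc i) = i<j⇒1≤j-i (ℤP.≤-<-trans (ℤ.+≤+ (ℕ.s≤s ℕ.z≤n)) (index<D (suc i)))
    step : ∀ i → term i ℚ.+ E (suc i) ℚ.≤ E i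
    step i = recip-+-recip-≤-recip (1≤Y i) (1≤D-1 i) (1≤D-1 (suc i))
               (reciprocal-upper-step (bounded i))

  floorInvSeries : FloorInvSeries term (D 0 - 1ℤ)
  floorInvSeries = (λ i → recip-pos (1≤Y i)) , upper , (j , lower)
    where
    upper : ∀ j → ((D 0 - 1ℤ) ℚ./ 1) ℚ.* partial term j ℚ.≤ ℚ.1ℚ
    upper j = ≤-recip⇒*≤1 (partial term j) (ℤP.i≤j⇒0≤j-i (1≤D 0)) (λ 1≤D₀-1 → partial-upper 1≤D₀-1 j)
    X : ℤ
    X = Y 0 * D 0 * D 1
    j : ℕ
    j = ℤ.∣ X ∣
    X<D : X < D (suc j)
    X<D = subst (_< D (suc j)) (ℤP.0≤i⇒+∣i∣≡i 0≤X) (ℤP.<-trans (index<D j) (gap-increasing (bounded j)))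
      where
      0≤X = *-pres-0≤ (*-pres-0≤ (1≤⇒0≤ (1≤Y 0)) (1≤⇒0≤ (1≤D 0))) (1≤⇒0≤ (1≤D 1))
    D₀-1+1 : ∀ d → d - 1ℤ + 1ℤ ≡ d
    D₀-1+1 = solve-∀
    lower : ℚ.1ℚ ℚ.< ((D 0 - 1ℤ + 1ℤ) ℚ./ 1) ℚ.* partial term j
    lower = subst (λ m → ℚ.1ℚ ℚ.< (m ℚ./ 1) ℚ.* partial term j) (sym (D₀-1+1 (D 0)))
      (1<*-by-margin (partial term j) (1≤Y 0) (1≤D 0) (1≤D 1) (1≤D (suc j))
        (reciprocal-lower-step (bounded 0)) X<D (partial-lower j))

partial-cong : ∀ {a b : ℕ → ℚ} → (∀ i → a i ≡ b i) → ∀ j → partial a j ≡ partial b j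
partial-cong a≡b zero = a≡b 0
partial-cong a≡b (suc j) = cong₂ ℚ._+_ (partial-cong a≡b j) (a≡b (suc j))

FloorInvSeries-cong : ∀ {a b : ℕ → ℚ} {m} → (∀ i → a i ≡ b i) → FloorInvSeries a m → FloorInvSeries b m
FloorInvSeries-cong {m = m} a≡b (pos , upper , (j , lower)) =
    (λ i → subst (ℚ.0ℚ ℚ.<_) (a≡b i) (pos i))
  , (λ j → subst (λ p → (m ℚ./ 1) ℚ.* p ℚ.≤ ℚ.1ℚ) (partial-cong a≡b j) (upper j))
  , (j , subst (λ p → ℚ.1ℚ ℚ.< ((m + 1ℤ) ℚ./ 1) ℚ.* p) (partial-cong a≡b j) lower)

floorInvSeries-tail : (x : ℕ → ℤ) → (∀ k → CassiniBounded (x k) (x (suc k)) (x (suc (suc k)))) →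
                      ∀ n → FloorInvSeries (λ i → recip (x (suc n ℕ.+ i))) (x (suc n) - x n - 1ℤ)
-- Shifting by k + n rather than n + k makes bounded (k + n) fit the shifted sequence as it is.
floorInvSeries-tail x bounded n =
  FloorInvSeries-cong {m = x (suc n) - x n - 1ℤ} (λ i → cong (λ k → recip (x (suc k))) (ℕP.+-comm i n))
    (CassiniBoundedSequence.floorInvSeries (λ k → x (k ℕ.+ n)) (λ k → bounded (k ℕ.+ n)))

*-suc′ : ∀ r k → r ℕ.* suc k ≡ r ℕ.* k ℕ.+ r
*-suc′ r k = trans (ℕP.*-suc r k) (ℕP.+-comm r (r ℕ.* k))

floorInvSeries-multiples : (y : ℕ → ℤ) (r : ℕ) →
  (∀ m → CassiniBounded (y m) (y (m ℕ.+ r)) (y (m ℕ.+ r ℕ.+ r))) →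
  ∀ n → FloorInvSeries (λ i → recip (y (r ℕ.* (suc n ℕ.+ i)))) (y (r ℕ.* suc n) - y (r ℕ.* n) - 1ℤ)
floorInvSeries-multiples y r bounded = floorInvSeries-tail (λ k → y (r ℕ.* k)) λ k →
  subst₂ (λ m m′ → CassiniBounded (y (r ℕ.* k)) (y m) (y m′))
    (sym (*-suc′ r k)) (sym (trans (*-suc′ r (suc k)) (cong (ℕ._+ r) (*-suc′ r k))))
    (bounded (r ℕ.* k))

module FibIdentities (s u : ℤ) where

  f : ℕ → ℤ
  f = fib s u

  fib-+ : ∀ n q → f (n ℕ.+ suc q) ≡ f (suc n) * f (suc q) + u * f n * f q
  fib-+ zero q = e s u (f (suc q)) (f q)
    where
    e : ∀ s u x y → x ≡ 1ℤ * x + u * 0ℤ * y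
    e = solve-∀
  fib-+ (suc zero) q = e s u (f (suc q)) (f q)
    where
    e : ∀ s u x y → s * x + u * y ≡ (s * 1ℤ + u * 0ℤ) * x + u * 1ℤ * y
    e = solve-∀
  fib-+ (suc (suc n)) q = begin
    s * f (suc n ℕ.+ suc q) + u * f (n ℕ.+ suc q)
      ≡⟨ cong₂ (λ p p′ → s * p + u * p′) (fib-+ (suc n) q) (fib-+ n q) ⟩
    s * (f (suc (suc n)) * f (suc q) + u * f (suc n) * f q) + u * (f (suc n) * f (suc q) + u * f n * f q)
      ≡⟨ e s u (f (suc n)) (f n) (f (suc q)) (f q) ⟩
    f (suc (suc (suc n))) * f (suc q) + u * f (suc (suc n)) * f q
      ∎
    where
    open ≡-Reasoning
    e : ∀ s u x y a b → s * ((s * x + u * y) * a + u * x * b) + u * (x * a + u * y * b)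
                      ≡ (s * (s * x + u * y) + u * x) * a + u * (s * x + u * y) * b
    e = solve-∀

  fib-cassini : ∀ m → f (suc m) * f (suc m) - s * f (suc m) * f m - u * f m * f m ≡ (- u) ^ m
  fib-cassini zero = e s u
    where
    e : ∀ s u → 1ℤ * 1ℤ - s * 1ℤ * 0ℤ - u * 0ℤ * 0ℤ ≡ 1ℤ
    e = solve-∀
  fib-cassini (suc m) = trans (e s u (f (suc m)) (f m)) (cong ((- u) *_) (fib-cassini m))
    where
    e : ∀ s u x y → (s * x + u * y) * (s * x + u * y) - s * (s * x + u * y) * x - u * x * x
                  ≡ (- u) * (x * x - s * x * y - u * y * y)
    e = solve-∀

  fib-catalan : ∀ m r → f (m ℕ.+ r) * f (m ℕ.+ r) - f m * f (m ℕ.+ r ℕ.+ r) ≡ f r * f r * (- u) ^ m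
  fib-catalan m zero rewrite ℕP.+-identityʳ m | ℕP.+-identityʳ m = e (f m) ((- u) ^ m)
    where
    e : ∀ x p → x * x - x * x ≡ 0ℤ * 0ℤ * p
    e = solve-∀
  fib-catalan m (suc q) = begin
    f (m ℕ.+ r) * f (m ℕ.+ r) - f m * f (m ℕ.+ r ℕ.+ r) ≡⟨ cong₂ (λ z z′ → z * z - y * z′) (fib-+ m q) f[m+r+r] ⟩
    b * b - y * c                                       ≡⟨ e s u x y d d′ ⟩
    d * d * (x * x - s * x * y - u * y * y)             ≡⟨ cong (d * d *_) (fib-cassini m) ⟩
    d * d * (- u) ^ m                                   ∎
    where
    open ≡-Reasoning
    r = suc q
    d = f r
    d′ = f q
    x = f (suc m)
    y = f m
    b = x * d + u * y * d′
    c = ((s * x + u * y) * d + u * x * d′) * d + u * b * d′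
    f[m+r+r] : f (m ℕ.+ r ℕ.+ r) ≡ c
    f[m+r+r] = trans (fib-+ (m ℕ.+ r) q) (cong₂ (λ z z′ → z * d + u * z′ * d′) (fib-+ (suc m) q) (fib-+ m q))
    e : ∀ s u x y d d′ →
        (x * d + u * y * d′) * (x * d + u * y * d′)
          - y * (((s * x + u * y) * d + u * x * d′) * d + u * (x * d + u * y * d′) * d′)
        ≡ d * d * (x * x - s * x * y - u * y * y)
    e = solve-∀

module FibGrowth (s t : ℤ) (1≤t : 1ℤ ≤ t) (t<s : t < s) where
  open FibIdentities s (- t) public

  g : ℕ → ℤ
  g m = f (suc m) - t * f m

  private
    0≤s-t-1 : 0ℤ ≤ s - t - 1ℤ
    0≤s-t-1 = ℤP.i≤j⇒0≤j-i (i<j⇒1≤j-i t<s)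

    g-increment : ∀ m → g (suc m) - g m ≡ (s - t - 1ℤ) * f (suc m)
    g-increment m = e s t (f (suc m)) (f m)
      where
      e : ∀ s t x y → (s * x + (- t) * y - t * x) - (x - t * y) ≡ (s - t - 1ℤ) * x
      e = solve-∀

    0≤f×1≤g : ∀ m → 0ℤ ≤ f m × 1ℤ ≤ g m
    0≤f×1≤g zero = ℤP.≤-refl , ℤP.≤-reflexive (sym (e t))
      where
      e : ∀ t → 1ℤ - t * 0ℤ ≡ 1ℤ
      e = solve-∀
    0≤f×1≤g (suc m) with 0≤f×1≤g m
    ... | 0≤fm , 1≤gm = 0≤f[1+m]
                      , ℤP.≤-trans 1≤gm (≤-by-difference _ (g-increment m) (*-pres-0≤ 0≤s-t-1 0≤f[1+m]))
      where
      0≤f[1+m] : 0ℤ ≤ f (suc m)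
      0≤f[1+m] = ≤-by-difference _ (cert t (f (suc m)) (f m))
        (+-pres-0≤ (*-pres-0≤ (1≤⇒0≤ 1≤t) 0≤fm) (1≤⇒0≤ 1≤gm))
        where
        cert : ∀ t x y → x - 0ℤ ≡ t * y + (x - t * y)
        cert = solve-∀

  0≤f : ∀ m → 0ℤ ≤ f m
  0≤f m = proj₁ (0≤f×1≤g m)

  1≤g : ∀ m → 1ℤ ≤ g m
  1≤g m = proj₂ (0≤f×1≤g m)

  g-mono : ∀ {m n} → m ℕ.≤ n → g m ≤ g n
  g-mono = mono-of-step g λ m → ≤-by-difference _ (g-increment m) (*-pres-0≤ 0≤s-t-1 (0≤f (suc m)))

  f-strictMono : ∀ {m n} → m ℕ.< n → f m < f n
  f-strictMono = strictMono-of-step f λ m → <-by-difference _ (cert t (f (suc m)) (f m))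
    (ℤP.+-mono-≤ (1≤g m) (*-pres-0≤ (ℤP.i≤j⇒0≤j-i 1≤t) (0≤f m)))
    where
    cert : ∀ t x y → x - y ≡ (x - t * y) + (t - 1ℤ) * y
    cert = solve-∀

module FibCassiniBounded (s t : ℤ) (2≤t : + 2 ≤ t) (t<s : t < s) (q : ℕ) where
  private
    1≤t : 1ℤ ≤ t
    1≤t = ℤP.≤-trans (ℤ.+≤+ (ℕ.s≤s ℕ.z≤n)) 2≤t

  open FibGrowth s t 1≤t t<s

  r : ℕ
  r = suc q

  d : ℤ
  d = f r

  1≤d : 1ℤ ≤ d
  1≤d = ℤP.i<j⇒suc[i]≤j (f-strictMono {0} {r} (ℕ.s≤s ℕ.z≤n))

  gap : ℕ → ℤ
  gap m = f (m ℕ.+ r ℕ.+ r) - f (m ℕ.+ r)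

  t*gap≤gap-suc : ∀ m → t * gap m ≤ gap (suc m)
  t*gap≤gap-suc m = ≤-by-difference _ (cert t (f (suc (m+r+r))) (f m+r+r) (f (suc (m+r))) (f m+r))
    (ℤP.i≤j⇒0≤j-i (g-mono (ℕP.m≤m+n m+r r)))
    where
    m+r = m ℕ.+ r
    m+r+r = m+r ℕ.+ r
    cert : ∀ t x′ x y′ y → (x′ - y′) - t * (x - y) ≡ (x′ - t * x) - (y′ - t * y)
    cert = solve-∀

  2≤f[r+1]-t*f[r-1]-f[r] : + 2 ≤ f (suc r) - t * f q - d
  2≤f[r+1]-t*f[r-1]-f[r] = ≤-by-difference _ (cert t (f (suc r)) d (f q))
    (+-pres-0≤ (+-pres-0≤ (ℤP.i≤j⇒0≤j-i (1≤g r)) (ℤP.i≤j⇒0≤j-i (*-pres-1≤ 1≤t-1 (1≤g q))))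
               (*-pres-0≤ (1≤⇒0≤ 1≤t) (*-pres-0≤ (ℤP.i≤j⇒0≤j-i 2≤t) (0≤f q))))
    where
    1≤t-1 : 1ℤ ≤ t - 1ℤ
    1≤t-1 = i<j⇒1≤j-i (ℤP.suc[i]≤j⇒i<j 2≤t)
    cert : ∀ t z y x → (z - t * x - y) - + 2
                     ≡ ((z - t * y) - 1ℤ) + ((t - 1ℤ) * (y - t * x) - 1ℤ) + t * ((t - + 2) * x)
    cert = solve-∀

  d*d<gap : d * d < gap 0
  d*d<gap = <-by-difference _ (trans (cong (λ z → z - d - d * d) (fib-+ r q)) (cert t (f (suc r)) d (f q)))
    (ℤP.+-mono-≤ 1≤d (*-pres-0≤ (1≤⇒0≤ 1≤d) (ℤP.i≤j⇒0≤j-i 2≤f[r+1]-t*f[r-1]-f[r])))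
    where
    cert : ∀ t z y x → z * y + (- t) * y * x - y - y * y ≡ y + y * ((z - t * x - y) - + 2)
    cert = solve-∀

  t^m*d*d<gap : ∀ m → t ^ m * (d * d) < gap m
  t^m*d*d<gap zero = subst (_< gap 0) (sym (ℤP.*-identityˡ (d * d))) d*d<gap
  t^m*d*d<gap (suc m) = begin-strict
    t * t ^ m * (d * d)   ≡⟨ ℤP.*-assoc t (t ^ m) (d * d) ⟩
    t * (t ^ m * (d * d)) <⟨ ℤP.*-monoˡ-<-pos t {{ℤ.positive 0<t}} (t^m*d*d<gap m) ⟩
    t * gap m               ≤⟨ t*gap≤gap-suc m ⟩
    gap (suc m)             ∎
    where
    open ℤP.≤-Reasoning
    0<t = ℤP.<-≤-trans (ℤ.+<+ (ℕ.s≤s ℕ.z≤n)) 1≤t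

  bounded : ∀ m → CassiniBounded (f m) (f (m ℕ.+ r)) (f (m ℕ.+ r ℕ.+ r))
  bounded m = record
    { 0≤a         = 0≤f m
    ; a<b         = f-strictMono (ℕP.m<m+n m (ℕ.s≤s ℕ.z≤n))
    ; 0<cassini   = subst (0ℤ <_) (sym catalan)
                      (ℤP.suc[i]≤j⇒i<j (*-pres-1≤ (^-pres-1≤ 1≤t m) (*-pres-1≤ 1≤d 1≤d)))
    ; cassini<c-b = subst (_< gap m) (sym catalan) (t^m*d*d<gap m)
    }
    where
    catalan : cassini (f m) (f (m ℕ.+ r)) (f (m ℕ.+ r ℕ.+ r)) ≡ t ^ m * (d * d)
    catalan = trans (fib-catalan m r)
      (trans (cong (λ z → d * d * z ^ m) (ℤP.neg-involutive t)) (ℤP.*-comm (d * d) (t ^ m)))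

squares-cassiniBounded : ∀ {a b c d} → 0ℤ ≤ a → a < b → 1ℤ ≤ d → cassini a b c ≡ d * d → + 3 * d * b ≤ c →
                         CassiniBounded (a * a) (b * b) (c * c)
squares-cassiniBounded {a} {b} {c} {d} 0≤a a<b 1≤d cassini≡d*d 3db≤c = record
  { 0≤a = *-pres-0≤ 0≤a 0≤a
  ; a<b = ℤP.suc[i]≤j⇒i<j (≤-by-difference _ (cert₁ a b)
            (+-pres-0≤ (*-pres-0≤ (ℤP.i≤j⇒0≤j-i (ℤP.i<j⇒suc[i]≤j a<b)) (+-pres-0≤ (+-pres-0≤ 0≤b 0≤a) 0≤1))
                       (+-pres-0≤ 0≤a 0≤a)))
  ; 0<cassini = ℤP.suc[i]≤j⇒i<j (subst (1ℤ ≤_) (sym cassini-squares)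
                  (*-pres-1≤ 1≤dd (ℤP.+-mono-≤ (*-pres-1≤ 1≤b 1≤b) (*-pres-0≤ 0≤a 0≤c))))
  ; cassini<c-b = ℤP.suc[i]≤j⇒i<j (subst (λ z → 1ℤ + z ≤ c * c - b * b) (sym cassini-squares′)
                    (≤-by-difference _ (cert₂ b c d) (+-pres-0≤ (+-pres-0≤
                      (*-pres-0≤ (ℤP.i≤j⇒0≤j-i 3db≤c) (+-pres-0≤ 0≤c 0≤3db))
                      (*-pres-0≤ (*-pres-0≤ 0≤b 0≤b) (+-pres-0≤ (*-pres-0≤ 0≤7 0≤dd-1) 0≤6)))
                      (*-pres-0≤ 0≤dd-1 (+-pres-0≤ (1≤⇒0≤ 1≤dd) 0≤1)))))
  }
  where
  0≤1 = ℤP.nonNegative⁻¹ (+ 1)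
  0≤6 = ℤP.nonNegative⁻¹ (+ 6)
  0≤7 = ℤP.nonNegative⁻¹ (+ 7)
  1≤b = 0≤i<j⇒1≤j 0≤a a<b
  0≤b = 1≤⇒0≤ 1≤b
  1≤dd = *-pres-1≤ 1≤d 1≤d
  0≤dd-1 = ℤP.i≤j⇒0≤j-i 1≤dd
  0≤3db = *-pres-0≤ (*-pres-0≤ (ℤP.nonNegative⁻¹ (+ 3)) (1≤⇒0≤ 1≤d)) 0≤b
  0≤c = ℤP.≤-trans 0≤3db 3db≤c
  cassini-squares : cassini (a * a) (b * b) (c * c) ≡ d * d * (b * b + a * c)
  cassini-squares = trans (e₂ a b c) (cong (_* (b * b + a * c)) cassini≡d*d)
    where
    e₂ : ∀ a b c → b * b * (b * b) - a * a * (c * c) ≡ (b * b - a * c) * (b * b + a * c)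
    e₂ = solve-∀
  cassini-squares′ : cassini (a * a) (b * b) (c * c) ≡ d * d * (+ 2 * (b * b) - d * d)
  cassini-squares′ = trans (e₂′ a b c) (cong (λ k → k * (+ 2 * (b * b) - k)) cassini≡d*d)
    where
    e₂′ : ∀ a b c → b * b * (b * b) - a * a * (c * c) ≡ (b * b - a * c) * (+ 2 * (b * b) - (b * b - a * c))
    e₂′ = solve-∀
  cert₁ : ∀ a b → b * b - (1ℤ + a * a) ≡ (b - (1ℤ + a)) * (b + a + 1ℤ) + (a + a)
  cert₁ = solve-∀
  cert₂ : ∀ b c d → c * c - b * b - (1ℤ + d * d * (+ 2 * (b * b) - d * d))
               ≡ (c - + 3 * d * b) * (c + + 3 * d * b) + b * b * (+ 7 * (d * d - 1ℤ) + + 6)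
                 + (d * d - 1ℤ) * (d * d + 1ℤ)
  cert₂ = solve-∀

module FibSquaresCassiniBounded (s : ℤ) (5≤s : + 5 ≤ s) (q : ℕ) where
  open FibGrowth s 1ℤ ℤP.≤-refl (ℤP.<-≤-trans (ℤ.+<+ (ℕ.s≤s (ℕ.s≤s ℕ.z≤n))) 5≤s)

  r : ℕ
  r = suc q

  d : ℤ
  d = f r

  1≤d : 1ℤ ≤ d
  1≤d = ℤP.i<j⇒suc[i]≤j (f-strictMono {0} {r} (ℕ.s≤s ℕ.z≤n))

  [s-1]*f≤f-suc : ∀ m → (s - 1ℤ) * f m ≤ f (suc m)
  [s-1]*f≤f-suc zero = ≤-by-difference _ (cert s) (ℤP.nonNegative⁻¹ (+ 1))
    where
    cert : ∀ s → 1ℤ - (s - 1ℤ) * 0ℤ ≡ 1ℤ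
    cert = solve-∀
  [s-1]*f≤f-suc (suc m) = ≤-by-difference _ (cert s (f (suc m)) (f m))
    (ℤP.i≤j⇒0≤j-i (ℤP.<⇒≤ (f-strictMono (ℕP.n<1+n m))))
    where
    cert : ∀ s x y → s * x + (- 1ℤ) * y - (s - 1ℤ) * x ≡ x - y
    cert = solve-∀

  3*d*f[m+r]≤f[m+r+r] : ∀ m → + 3 * d * f (m ℕ.+ r) ≤ f (m ℕ.+ r ℕ.+ r)
  3*d*f[m+r]≤f[m+r+r] m = ≤-by-difference _
    (trans (cong (_- + 3 * d * b) (fib-+ (m ℕ.+ r) q)) (cert s d b (f (suc (m ℕ.+ r))) (f q)))
    (+-pres-0≤ (+-pres-0≤
      (*-pres-0≤ (1≤⇒0≤ 1≤d) (ℤP.i≤j⇒0≤j-i ([s-1]*f≤f-suc (m ℕ.+ r))))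
      (*-pres-0≤ (ℤP.i≤j⇒0≤j-i (ℤP.<⇒≤ (f-strictMono (ℕP.n<1+n q)))) (0≤f (m ℕ.+ r))))
      (*-pres-0≤ (*-pres-0≤ (1≤⇒0≤ 1≤d) (0≤f (m ℕ.+ r))) (ℤP.i≤j⇒0≤j-i 5≤s)))
    where
    b = f (m ℕ.+ r)
    cert : ∀ s d b z y → z * d + (- 1ℤ) * b * y - + 3 * d * b
                       ≡ d * (z - (s - 1ℤ) * b) + (d - y) * b + d * b * (s - + 5)
    cert = solve-∀

  bounded : ∀ m → CassiniBounded (f m * f m) (f (m ℕ.+ r) * f (m ℕ.+ r))
                                 (f (m ℕ.+ r ℕ.+ r) * f (m ℕ.+ r ℕ.+ r))
  bounded m = squares-cassiniBounded (0≤f m) (f-strictMono (ℕP.m<m+n m (ℕ.s≤s ℕ.z≤n))) 1≤d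
    (trans (fib-catalan m r) (trans (cong (d * d *_) (ℤP.^-zeroˡ m)) (ℤP.*-identityʳ (d * d))))
    (3*d*f[m+r]≤f[m+r+r] m)

theorem18 :
    (∀ (n r : ℕ) → 1 ℕ.≤ n → 1 ℕ.≤ r →
      ∃[ N ] ∀ (s t : ℤ) → t ℤ.< s → N ℤ.≤ t →
        FloorInvSeries (λ i → recip (fib s (- t) (r ℕ.* (n ℕ.+ i))))
          (fib s (- t) (r ℕ.* n) ℤ.- fib s (- t) (r ℕ.* (n ℕ.∸ 1)) ℤ.- + 1))
    × (∀ (n r : ℕ) → 1 ℕ.≤ n → 1 ℕ.≤ r →
      ∃[ S ] ∀ (s : ℤ) → S ℤ.≤ s →
        FloorInvSeries (λ i → recip (fib s (- + 1) (r ℕ.* (n ℕ.+ i)) ℤ.* fib s (- + 1) (r ℕ.* (n ℕ.+ i))))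
          (fib s (- + 1) (r ℕ.* n) ℤ.* fib s (- + 1) (r ℕ.* n)
            ℤ.- fib s (- + 1) (r ℕ.* (n ℕ.∸ 1)) ℤ.* fib s (- + 1) (r ℕ.* (n ℕ.∸ 1)) ℤ.- + 1))
theorem18 =
    (λ { (suc n) (suc q) _ _ → + 2 , λ s t t<s 2≤t →
           floorInvSeries-multiples (fib s (- t)) (suc q) (FibCassiniBounded.bounded s t 2≤t t<s q) n })
  , (λ { (suc n) (suc q) _ _ → + 5 , λ s 5≤s →
           floorInvSeries-multiples (λ m → fib s (- + 1) m * fib s (- + 1) m) (suc q)
             (FibSquaresCassiniBounded.bounded s 5≤s q) n })
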